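{- Let $k$ be an l-closed differential field of characteristic $0$, and let $W$ be the $\mathbb{Q}$-linear space spanned by the derivatives $v'$ of logarithmic elements $v$ of $k$. Let $k(\theta)$ be a differential field extension of $k$ with the same constants as $k$. (i) If $f \in k$, $f\ne0$, and $\theta' = f'/f$, then $\theta$ is transcendental over $k$ if and only if $f'/f \notin W$. (ii) If $f \in k$ and $\theta' = f'\theta$ (with $\theta\neq 0$), then $\theta$ is transcendental over $k$ if and only if $f' \notin W$.
   Context: An element $v$ of a differential field $k$ is a logarithmic element if there is a nonzero $u\in k$ with $v' = u'/u$. A constant is an element with zero derivative. A differential field $k$ is l-closed if for every algebraic extension $E$ of $k$: whenever $c_1,\dots,c_n\in E$ are constants linearly independent over $\mathbb{Q}$, $u_i \in E$ nonzero, $v\in E$, and $\sum c_iu_i'/u_i = v'$, then for each $i$ some positive power of $u_i$ equals a constant multiple of an element of $k$. -}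

module Defs where

open import Level using (Level; _⊔_) renaming (suc to lsuc)
open import Algebra.Bundles using (CommutativeRing)
open import Data.Nat using (ℕ; zero; suc)
open import Data.Integer using (ℤ; +_; -[1+_])
open import Data.Rational using (ℚ; 0ℚ)
import Data.Rational as ℚ
open import Data.Fin using (Fin; zero; suc)
open import Data.List using (List; []; _∷_)
open import Data.List.Relation.Unary.Any using (Any)
open import Data.Product using (Σ; ∃; _×_; _,_)
open import Relation.Nullary using (¬_)
open import Relation.Binary.PropositionalEquality using (_≡_)

record DiffField (c ℓ : Level) : Set (lsuc (c ⊔ ℓ)) where
  field
    commRing : CommutativeRing c ℓ
  open CommutativeRing commRing public
    using (Carrier; _≈_; _+_; _*_; -_; 0#; 1#; setoid; refl; sym; trans)
  field
    _⁻¹       : Carrier → Carrier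
    1≉0       : ¬ (1# ≈ 0#)
    ⁻¹-inverse : ∀ x → ¬ (x ≈ 0#) → (x * (x ⁻¹)) ≈ 1#
    ∂         : Carrier → Carrier
    ∂-cong    : ∀ {x y} → x ≈ y → ∂ x ≈ ∂ y
    ∂-+       : ∀ x y → ∂ (x + y) ≈ (∂ x + ∂ y)
    ∂-*       : ∀ x y → ∂ (x * y) ≈ ((∂ x * y) + (x * ∂ y))

  logD : Carrier → Carrier
  logD u = ∂ u * (u ⁻¹)

  IsConst : Carrier → Set ℓ
  IsConst x = ∂ x ≈ 0#

  natE : ℕ → Carrier
  natE zero    = 0#
  natE (suc n) = 1# + natE n

  intE : ℤ → Carrier
  intE (+ n)      = natE n
  intE -[1+ n ]   = - natE (suc n)

  ratE : ℚ → Carrier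
  ratE r = intE (ℚ.numerator r) * (natE (ℚ.denominatorℕ r) ⁻¹)

  _^_ : Carrier → ℕ → Carrier
  x ^ zero  = 1#
  x ^ suc n = x * (x ^ n)

  Σ[_] : ∀ {n} → (Fin n → Carrier) → Carrier
  Σ[_] {zero}  f = 0#
  Σ[_] {suc n} f = f zero + Σ[_] (λ i → f (suc i))

  CharZero : Set ℓ
  CharZero = ∀ n → natE n ≈ 0# → n ≡ 0

  IsLog : Carrier → Set (c ⊔ ℓ)
  IsLog v = Σ Carrier λ u → ¬ (u ≈ 0#) × (∂ v ≈ logD u)

  InW : Carrier → Set (c ⊔ ℓ)
  InW w = Σ ℕ λ n → Σ (Fin n → ℚ) λ q → Σ (Fin n → Carrier) λ v →
            (∀ i → IsLog (v i)) × (w ≈ Σ[ (λ i → ratE (q i) * ∂ (v i)) ])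

  ℚLinIndep : ∀ {n} → (Fin n → Carrier) → Set ℓ
  ℚLinIndep {n} cs = ∀ (q : Fin n → ℚ) →
    Σ[ (λ i → ratE (q i) * cs i) ] ≈ 0# → ∀ i → q i ≡ 0ℚ

record DiffExt {c ℓ c' ℓ'} (k : DiffField c ℓ) (K : DiffField c' ℓ')
       : Set (c ⊔ ℓ ⊔ c' ⊔ ℓ') where
  private
    module k = DiffField k
    module K = DiffField K
  field
    ι      : k.Carrier → K.Carrier
    ι-cong : ∀ {x y} → x k.≈ y → ι x K.≈ ι y
    ι-inj  : ∀ {x y} → ι x K.≈ ι y → x k.≈ y
    ι-+    : ∀ x y → ι (x k.+ y) K.≈ (ι x K.+ ι y)
    ι-*    : ∀ x y → ι (x k.* y) K.≈ (ι x K.* ι y)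
    ι-1    : ι k.1# K.≈ K.1#
    ι-∂    : ∀ x → ι (k.∂ x) K.≈ K.∂ (ι x)

  -- polynomials over k: coefficient lists, lowest degree first
  eval : List k.Carrier → K.Carrier → K.Carrier
  eval []       x = K.0#
  eval (a ∷ as) x = ι a K.+ (x K.* eval as x)

  NonzeroPoly : List k.Carrier → Set (c ⊔ ℓ)
  NonzeroPoly p = Any (λ a → ¬ (a k.≈ k.0#)) p

  IsAlgebraic : K.Carrier → Set (c ⊔ ℓ ⊔ ℓ')
  IsAlgebraic x = Σ (List k.Carrier) λ p → NonzeroPoly p × (eval p x K.≈ K.0#)

  IsTranscendental : K.Carrier → Set (c ⊔ ℓ ⊔ ℓ')
  IsTranscendental x = ¬ IsAlgebraic x

  AlgebraicExt : Set (c ⊔ ℓ ⊔ c' ⊔ ℓ')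
  AlgebraicExt = ∀ x → IsAlgebraic x

  GeneratedBy : K.Carrier → Set (c ⊔ c' ⊔ ℓ')
  GeneratedBy θ = ∀ x → Σ (List k.Carrier) λ p → Σ (List k.Carrier) λ q →
    ¬ (eval q θ K.≈ K.0#) × (x K.≈ (eval p θ K.* (eval q θ K.⁻¹)))

  SameConstants : Set (c ⊔ c' ⊔ ℓ')
  SameConstants = ∀ x → K.IsConst x → Σ k.Carrier λ a → ι a K.≈ x

-- l-closed (quantifying over algebraic extensions E at the same universe levels)
LClosed : ∀ {c ℓ} → DiffField c ℓ → Set (lsuc (c ⊔ ℓ))
LClosed {c} {ℓ} k =
  (E : DiffField c ℓ) (e : DiffExt k E) → DiffExt.AlgebraicExt e →
  let module E = DiffField E in
  (n : ℕ) (cs us : Fin n → E.Carrier) (v : E.Carrier) →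
  (∀ i → E.IsConst (cs i)) → E.ℚLinIndep cs →
  (∀ i → ¬ (us i E.≈ E.0#)) →
  E.Σ[ (λ i → cs i E.* E.logD (us i)) ] E.≈ E.∂ v →
  ∀ i → Σ ℕ λ m → Σ E.Carrier λ d → Σ (DiffField.Carrier k) λ a →
    E.IsConst d × ((us i E.^ suc m) E.≈ (d E.* DiffExt.ι e a))

module Submission where

-- An algebraic relation for θ of degree n with leading coefficient x can be differentiated, and x
-- times the derivative minus its leading coefficient times the relation has degree < n.  Descending
-- on n, θ is transcendental unless at some stage this combination vanishes identically, which forces
-- a positive integer multiple of θ′ (when θ′ ∈ k) to be a derivative in k, or of θ′/θ to be a
-- logarithmic derivative in k; clearing denominators, these say exactly f′/f ∈ W, resp. f′ ∈ W.
-- Conversely θ − w, resp. θⁿ⁺¹/u, is then constant, hence in k.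

open import Defs
open import Data.Product using (_×_)
open import Relation.Nullary using (¬_)
open import Function.Bundles using (_⇔_)

open import Level using (_⊔_)
open import Algebra.Bundles using (CommutativeRing)
import Algebra.Properties.Ring as RingProperties
import Algebra.Solver.Ring as RingSolver
import Algebra.Solver.Ring.AlmostCommutativeRing as AlmostCommutativeRing
open import Data.Empty using (⊥)
open import Data.Fin using (Fin; zero; suc)
open import Data.Integer as ℤ using (ℤ; +_; -[1+_])
import Data.Integer.Properties as ℤ
open import Data.List using (List; []; _∷_; length; reverse; _++_; zipWith)
import Data.List.Properties as List
open import Data.List.Relation.Unary.All using (All; []; _∷_)
open import Data.List.Relation.Unary.All.Properties using (¬Any⇒All¬)
open import Data.List.Relation.Unary.Any using (Any; here; there)
import Data.List.Relation.Unary.Any.Properties as Any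
open import Data.Maybe using (Maybe; just; nothing)
open import Data.Nat as ℕ using (ℕ; zero; suc; s≤s)
import Data.Nat.Properties as ℕ
open import Data.Nat.Coprimality using (1-coprimeTo)
open import Data.Product using (Σ; _,_; proj₁; proj₂)
import Data.Rational as ℚ
open import Data.Rational using (ℚ)
open import Data.Sign using (Sign)
open import Function.Bundles using (mk⇔)
open import Relation.Binary.PropositionalEquality as ≡ using (_≡_)
open import Relation.Nullary using (yes; no)

All¬¬⇒¬¬All : ∀ {a p} {A : Set a} {P : A → Set p} xs →
              All (λ x → ¬ ¬ P x) xs → ¬ ¬ All P xs
All¬¬⇒¬¬All []       []         k = k []
All¬¬⇒¬¬All (x ∷ xs) (¬¬p ∷ ¬¬ps) k = ¬¬p (λ p → All¬¬⇒¬¬All xs ¬¬ps (λ ps → k (p ∷ ps)))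

module DiffFieldProperties {c ℓ} (k : DiffField c ℓ) where
  open DiffField k
  open CommutativeRing commRing public
    using ( +-cong; *-cong; -‿cong; +-assoc; *-assoc; +-comm; *-comm; +-identityˡ; +-identityʳ
          ; *-identityˡ; *-identityʳ; -‿inverseʳ; -‿inverseˡ; distribʳ; zeroˡ; zeroʳ; reflexive)
  open RingProperties (CommutativeRing.ring commRing) public
    using (-‿distribˡ-*; -‿distribʳ-*; +-inverseʳ-unique; -0#≈0#; -‿involutive; -‿anti-homo-+; x+x≈x⇒x≈0)
  open import Relation.Binary.Reasoning.Setoid setoid

  natE-+ : ∀ m n → natE (m ℕ.+ n) ≈ natE m + natE n
  natE-+ zero    n = sym (+-identityˡ _)
  natE-+ (suc m) n = trans (+-cong refl (natE-+ m n)) (sym (+-assoc _ _ _))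

  natE-* : ∀ m n → natE (m ℕ.* n) ≈ natE m * natE n
  natE-* zero    n = sym (zeroˡ _)
  natE-* (suc m) n = begin
    natE (n ℕ.+ m ℕ.* n)          ≈⟨ natE-+ n (m ℕ.* n) ⟩
    natE n + natE (m ℕ.* n)       ≈⟨ +-cong (sym (*-identityˡ _)) (natE-* m n) ⟩
    1# * natE n + natE m * natE n ≈⟨ sym (distribʳ _ _ _) ⟩
    (1# + natE m) * natE n        ∎

  natE-suc-* : ∀ n x → natE (suc n) * x ≈ x + natE n * x
  natE-suc-* n x = trans (distribʳ _ _ _) (+-cong (*-identityˡ x) refl)

  -‿distrib-+ : ∀ x y → - (x + y) ≈ - x + - y
  -‿distrib-+ x y = trans (-‿anti-homo-+ x y) (+-comm _ _)

  intE-⊖ : ∀ m n → intE (m ℤ.⊖ n) ≈ natE m + - natE n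
  intE-⊖ m zero rewrite ℤ.⊖-≥ {m} {0} ℕ.z≤n =
    sym (trans (+-cong refl -0#≈0#) (+-identityʳ _))
  intE-⊖ zero (suc n) rewrite ℤ.⊖-< {0} {suc n} (s≤s ℕ.z≤n) = sym (+-identityˡ _)
  intE-⊖ (suc m) (suc n) rewrite ℤ.[1+m]⊖[1+n]≡m⊖n m n = begin
    intE (m ℤ.⊖ n)                       ≈⟨ intE-⊖ m n ⟩
    natE m + - natE n                    ≈⟨ sym (+-identityˡ _) ⟩
    0# + (natE m + - natE n)             ≈⟨ +-cong (sym (-‿inverseʳ 1#)) refl ⟩
    (1# + - 1#) + (natE m + - natE n)    ≈⟨ +-assoc _ _ _ ⟩
    1# + (- 1# + (natE m + - natE n))    ≈⟨ +-cong refl (sym (+-assoc _ _ _)) ⟩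
    1# + ((- 1# + natE m) + - natE n)    ≈⟨ +-cong refl (+-cong (+-comm _ _) refl) ⟩
    1# + ((natE m + - 1#) + - natE n)    ≈⟨ +-cong refl (+-assoc _ _ _) ⟩
    1# + (natE m + (- 1# + - natE n))    ≈⟨ sym (+-assoc _ _ _) ⟩
    (1# + natE m) + (- 1# + - natE n)    ≈⟨ +-cong refl (sym (-‿distrib-+ _ _)) ⟩
    natE (suc m) + - natE (suc n)        ∎

  intE-+ : ∀ i j → intE (i ℤ.+ j) ≈ intE i + intE j
  intE-+ -[1+ m ] -[1+ n ] = begin
    - natE (suc (suc (m ℕ.+ n)))     ≈⟨ -‿cong (reflexive (≡.cong natE (≡.sym (ℕ.+-suc (suc m) n)))) ⟩
    - natE (suc m ℕ.+ suc n)         ≈⟨ -‿cong (natE-+ (suc m) (suc n)) ⟩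
    - (natE (suc m) + natE (suc n))  ≈⟨ -‿distrib-+ _ _ ⟩
    - natE (suc m) + - natE (suc n)  ∎
  intE-+ -[1+ m ] (+ n)    = trans (intE-⊖ n (suc m)) (+-comm _ _)
  intE-+ (+ m)    -[1+ n ] = intE-⊖ m (suc n)
  intE-+ (+ m)    (+ n)    = natE-+ m n

  private
    signed : Sign → Carrier → Carrier
    signed Sign.+ x = x
    signed Sign.- x = - x

    intE-◃ : ∀ s n → intE (s ℤ.◃ n) ≈ signed s (natE n)
    intE-◃ Sign.+ zero    = refl
    intE-◃ Sign.- zero    = sym -0#≈0#
    intE-◃ Sign.+ (suc n) = refl
    intE-◃ Sign.- (suc n) = refl

  intE-* : ∀ i j → intE (i ℤ.* j) ≈ intE i * intE j
  intE-* -[1+ m ] -[1+ n ] = trans (intE-◃ Sign.+ (suc m ℕ.* suc n)) (begin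
    natE (suc m ℕ.* suc n)                  ≈⟨ natE-* (suc m) (suc n) ⟩
    natE (suc m) * natE (suc n)             ≈⟨ sym (-‿involutive _) ⟩
    - (- (natE (suc m) * natE (suc n)))     ≈⟨ -‿cong (-‿distribˡ-* _ _) ⟩
    - ((- natE (suc m)) * natE (suc n))     ≈⟨ -‿distribʳ-* _ _ ⟩
    (- natE (suc m)) * (- natE (suc n))     ∎)
  intE-* -[1+ m ] (+ n)    =
    trans (intE-◃ Sign.- (suc m ℕ.* n)) (trans (-‿cong (natE-* (suc m) n)) (-‿distribˡ-* _ _))
  intE-* (+ m)    -[1+ n ] =
    trans (intE-◃ Sign.- (m ℕ.* suc n)) (trans (-‿cong (natE-* m (suc n))) (-‿distribʳ-* _ _))
  intE-* (+ m)    (+ n)    = trans (intE-◃ Sign.+ (m ℕ.* n)) (natE-* m n)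

  intE-neg : ∀ i → intE (ℤ.- i) ≈ - intE i
  intE-neg -[1+ n ]    = sym (-‿involutive _)
  intE-neg (+ zero)    = sym -0#≈0#
  intE-neg (+ suc n)   = refl

  private
    intE-morphism : ℤ.+-*-rawRing AlmostCommutativeRing.-Raw-AlmostCommutative⟶
                    AlmostCommutativeRing.fromCommutativeRing commRing
    intE-morphism = record
      { ⟦_⟧ = intE ; +-homo = intE-+ ; *-homo = intE-* ; -‿homo = intE-neg
      ; 0-homo = refl ; 1-homo = +-identityʳ 1# }

    intE-≟ : ∀ i j → Maybe (intE i ≈ intE j)
    intE-≟ i j with i ℤ.≟ j
    ... | yes i≡j = just (reflexive (≡.cong intE i≡j))
    ... | no  _   = nothing

  open RingSolver ℤ.+-*-rawRing (AlmostCommutativeRing.fromCommutativeRing commRing) intE-morphism intE-≟ public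
    using (solve; _:=_; _:+_; _:*_; :-_; con)

  ⁻¹-inverseˡ : ∀ {x} → ¬ (x ≈ 0#) → x ⁻¹ * x ≈ 1#
  ⁻¹-inverseˡ x≉0 = trans (*-comm _ _) (⁻¹-inverse _ x≉0)

  *-cancelˡ : ∀ {x a b} → ¬ (x ≈ 0#) → x * a ≈ x * b → a ≈ b
  *-cancelˡ {x} {a} {b} x≉0 xa≈xb = begin
    a                 ≈⟨ sym (*-identityˡ a) ⟩
    1# * a            ≈⟨ *-cong (sym (⁻¹-inverseˡ x≉0)) refl ⟩
    (x ⁻¹ * x) * a    ≈⟨ *-assoc _ _ _ ⟩
    x ⁻¹ * (x * a)    ≈⟨ *-cong refl xa≈xb ⟩
    x ⁻¹ * (x * b)    ≈⟨ sym (*-assoc _ _ _) ⟩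
    (x ⁻¹ * x) * b    ≈⟨ *-cong (⁻¹-inverseˡ x≉0) refl ⟩
    1# * b            ≈⟨ *-identityˡ b ⟩
    b                 ∎

  *-nonzero : ∀ {x y} → ¬ (x ≈ 0#) → ¬ (y ≈ 0#) → ¬ (x * y ≈ 0#)
  *-nonzero x≉0 y≉0 xy≈0 = y≉0 (*-cancelˡ x≉0 (trans xy≈0 (sym (zeroʳ _))))

  ⁻¹-nonzero : ∀ {x} → ¬ (x ≈ 0#) → ¬ (x ⁻¹ ≈ 0#)
  ⁻¹-nonzero {x} x≉0 x⁻¹≈0 =
    1≉0 (trans (sym (⁻¹-inverse x x≉0)) (trans (*-cong refl x⁻¹≈0) (zeroʳ x)))

  ^-nonzero : ∀ {x} n → ¬ (x ≈ 0#) → ¬ (x ^ n ≈ 0#)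
  ^-nonzero zero    x≉0 = 1≉0
  ^-nonzero (suc n) x≉0 = *-nonzero x≉0 (^-nonzero n x≉0)

  ⁻¹-distrib-* : ∀ {x y} → ¬ (x ≈ 0#) → ¬ (y ≈ 0#) → (x * y) ⁻¹ ≈ x ⁻¹ * y ⁻¹
  ⁻¹-distrib-* {x} {y} x≉0 y≉0 = *-cancelˡ (*-nonzero x≉0 y≉0) (begin
    (x * y) * (x * y) ⁻¹        ≈⟨ ⁻¹-inverse _ (*-nonzero x≉0 y≉0) ⟩
    1#                          ≈⟨ sym (*-identityʳ 1#) ⟩
    1# * 1#                     ≈⟨ sym (*-cong (⁻¹-inverse x x≉0) (⁻¹-inverse y y≉0)) ⟩
    (x * x ⁻¹) * (y * y ⁻¹)     ≈⟨ solve 4 (λ x x' y y' → (x :* x') :* (y :* y')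
        := (x :* y) :* (x' :* y'))
        refl x (x ⁻¹) y (y ⁻¹) ⟩
    (x * y) * (x ⁻¹ * y ⁻¹)     ∎)

  ⁻¹-involutive : ∀ {x} → ¬ (x ≈ 0#) → (x ⁻¹) ⁻¹ ≈ x
  ⁻¹-involutive {x} x≉0 =
    *-cancelˡ (⁻¹-nonzero x≉0) (trans (⁻¹-inverse _ (⁻¹-nonzero x≉0)) (sym (⁻¹-inverseˡ x≉0)))

  natE-suc-nonzero : CharZero → ∀ n → ¬ (natE (suc n) ≈ 0#)
  natE-suc-nonzero charZero n n+1≈0 with charZero (suc n) n+1≈0
  ... | ()

  ∂-0 : ∂ 0# ≈ 0#
  ∂-0 = x+x≈x⇒x≈0 _ (trans (sym (∂-+ 0# 0#)) (∂-cong (+-identityʳ 0#)))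

  ∂-1 : ∂ 1# ≈ 0#
  ∂-1 = x+x≈x⇒x≈0 _ (begin
    ∂ 1# + ∂ 1#                ≈⟨ sym (+-cong (*-identityʳ _) (*-identityˡ _)) ⟩
    ∂ 1# * 1# + 1# * ∂ 1#      ≈⟨ sym (∂-* 1# 1#) ⟩
    ∂ (1# * 1#)                ≈⟨ ∂-cong (*-identityʳ 1#) ⟩
    ∂ 1#                       ∎)

  ∂-neg : ∀ x → ∂ (- x) ≈ - ∂ x
  ∂-neg x = +-inverseʳ-unique (∂ x) (∂ (- x))
    (trans (sym (∂-+ x (- x))) (trans (∂-cong (-‿inverseʳ x)) ∂-0))

  ∂-const-* : ∀ {a} x → IsConst a → ∂ (a * x) ≈ a * ∂ x
  ∂-const-* {a} x a′≈0 = begin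
    ∂ (a * x)            ≈⟨ ∂-* a x ⟩
    ∂ a * x + a * ∂ x    ≈⟨ +-cong (trans (*-cong a′≈0 refl) (zeroˡ x)) refl ⟩
    0# + a * ∂ x         ≈⟨ +-identityˡ _ ⟩
    a * ∂ x              ∎

  natE-const : ∀ n → IsConst (natE n)
  natE-const zero    = ∂-0
  natE-const (suc n) = trans (∂-+ 1# (natE n)) (trans (+-cong ∂-1 (natE-const n)) (+-identityˡ 0#))

  intE-const : ∀ i → IsConst (intE i)
  intE-const (+ n)    = natE-const n
  intE-const -[1+ n ] = trans (∂-neg _) (trans (-‿cong (natE-const (suc n))) -0#≈0#)

  ∂-⁻¹ : ∀ {x} → ¬ (x ≈ 0#) → ∂ (x ⁻¹) ≈ - (∂ x * (x ⁻¹ * x ⁻¹))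
  ∂-⁻¹ {x} x≉0 = *-cancelˡ x≉0 (begin
    x * ∂ (x ⁻¹)                    ≈⟨ +-inverseʳ-unique (∂ x * x ⁻¹) (x * ∂ (x ⁻¹)) x⁻¹-product-rule ⟩
    - (∂ x * x ⁻¹)                  ≈⟨ sym (*-identityʳ _) ⟩
    - (∂ x * x ⁻¹) * 1#             ≈⟨ *-cong refl (sym (⁻¹-inverse x x≉0)) ⟩
    - (∂ x * x ⁻¹) * (x * x ⁻¹)     ≈⟨ solve 3 (λ x x' d → (:- (d :* x')) :* (x :* x')
        := x :* (:- (d :* (x' :* x'))))
        refl x (x ⁻¹) (∂ x) ⟩
    x * - (∂ x * (x ⁻¹ * x ⁻¹))     ∎)
    where
    x⁻¹-product-rule : ∂ x * x ⁻¹ + x * ∂ (x ⁻¹) ≈ 0#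
    x⁻¹-product-rule = trans (sym (∂-* x (x ⁻¹))) (trans (∂-cong (⁻¹-inverse x x≉0)) ∂-1)

  ⁻¹-const : ∀ {x} → ¬ (x ≈ 0#) → IsConst x → IsConst (x ⁻¹)
  ⁻¹-const x≉0 x′≈0 =
    trans (∂-⁻¹ x≉0) (trans (-‿cong (trans (*-cong x′≈0 refl) (zeroˡ _))) -0#≈0#)

  ∂-neg-ratio : ∀ {x} s y → ¬ (x ≈ 0#) → x * (s * x + ∂ y) + - (∂ x * y) ≈ 0# → ∂ (- (y * x ⁻¹)) ≈ s
  ∂-neg-ratio {x} s y x≉0 eq = *-cancelˡ (*-nonzero x≉0 x≉0) (begin
    (x * x) * ∂ (- (y * x ⁻¹))
      ≈⟨ *-cong refl (trans (∂-neg _) (-‿cong (trans (∂-* y (x ⁻¹)) (+-cong refl (*-cong refl (∂-⁻¹ x≉0)))))) ⟩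
    (x * x) * - (∂ y * x ⁻¹ + y * - (∂ x * (x ⁻¹ * x ⁻¹)))
      ≈⟨ solve 5 (λ x y x′ y′ x' → (x :* x) :* :- (y′ :* x' :+ y :* :- (x′ :* (x' :* x')))
          := :- ((x :* y′) :* (x :* x')) :+ (y :* x′) :* ((x :* x') :* (x :* x')))
          refl x y (∂ x) (∂ y) (x ⁻¹) ⟩
    - ((x * ∂ y) * (x * x ⁻¹)) + (y * ∂ x) * ((x * x ⁻¹) * (x * x ⁻¹))
      ≈⟨ +-cong (-‿cong (trans (*-cong refl x*x⁻¹≈1) (*-identityʳ _)))
                (trans (*-cong refl (*-cong x*x⁻¹≈1 x*x⁻¹≈1)) (trans (*-cong refl (*-identityʳ 1#)) (*-identityʳ _))) ⟩
    - (x * ∂ y) + y * ∂ x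
      ≈⟨ sym (+-identityˡ _) ⟩
    0# + (- (x * ∂ y) + y * ∂ x)
      ≈⟨ +-cong (sym eq) refl ⟩
    (x * (s * x + ∂ y) + - (∂ x * y)) + (- (x * ∂ y) + y * ∂ x)
      ≈⟨ solve 5 (λ x y x′ y′ s → (x :* (s :* x :+ y′) :+ :- (x′ :* y)) :+ (:- (x :* y′) :+ y :* x′)
          := (x :* x) :* s)
          refl x y (∂ x) (∂ y) s ⟩
    (x * x) * s
      ∎)
    where
    x*x⁻¹≈1 : x * x ⁻¹ ≈ 1#
    x*x⁻¹≈1 = ⁻¹-inverse x x≉0

  ratE-const : CharZero → ∀ q → IsConst (ratE q)
  ratE-const charZero q = trans (∂-const-* _ (intE-const (ℚ.numerator q)))
    (trans (*-cong refl (⁻¹-const (natE-suc-nonzero charZero (ℚ.denominator-1 q))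
                                  (natE-const (ℚ.denominatorℕ q))))
           (zeroʳ _))

  denominator-*-ratE : CharZero → ∀ q → natE (ℚ.denominatorℕ q) * ratE q ≈ intE (ℚ.numerator q)
  denominator-*-ratE charZero q = begin
    d * (n * d ⁻¹)   ≈⟨ solve 3 (λ d n d' → d :* (n :* d') := n :* (d :* d')) refl d n (d ⁻¹) ⟩
    n * (d * d ⁻¹)   ≈⟨ *-cong refl (⁻¹-inverse d (natE-suc-nonzero charZero (ℚ.denominator-1 q))) ⟩
    n * 1#           ≈⟨ *-identityʳ _ ⟩
    n                ∎
    where
    n d : Carrier
    n = intE (ℚ.numerator q)
    d = natE (ℚ.denominatorℕ q)

  unitFraction : ℕ → ℚ
  unitFraction n = ℚ.mkℚ (+ 1) n (1-coprimeTo (suc n))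

  unitFraction-inverse : CharZero → ∀ n → ratE (unitFraction n) * natE (suc n) ≈ 1#
  unitFraction-inverse charZero n = begin
    ((1# + 0#) * N ⁻¹) * N   ≈⟨ solve 2 (λ N' N → (con (+ 1) :* N') :* N := N :* N') refl (N ⁻¹) N ⟩
    N * N ⁻¹                 ≈⟨ ⁻¹-inverse N (natE-suc-nonzero charZero n) ⟩
    1#                       ∎
    where
    N : Carrier
    N = natE (suc n)

  logD-* : ∀ {x y} → ¬ (x ≈ 0#) → ¬ (y ≈ 0#) → logD (x * y) ≈ logD x + logD y
  logD-* {x} {y} x≉0 y≉0 = begin
    ∂ (x * y) * (x * y) ⁻¹
      ≈⟨ *-cong (∂-* x y) (⁻¹-distrib-* x≉0 y≉0) ⟩
    (∂ x * y + x * ∂ y) * (x ⁻¹ * y ⁻¹)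
      ≈⟨ solve 6 (λ x y dx dy x' y' → (dx :* y :+ x :* dy) :* (x' :* y')
          := (dx :* x') :* (y :* y') :+ (dy :* y') :* (x :* x'))
          refl x y (∂ x) (∂ y) (x ⁻¹) (y ⁻¹) ⟩
    (∂ x * x ⁻¹) * (y * y ⁻¹) + (∂ y * y ⁻¹) * (x * x ⁻¹)
      ≈⟨ +-cong (*-cong refl (⁻¹-inverse y y≉0)) (*-cong refl (⁻¹-inverse x x≉0)) ⟩
    (∂ x * x ⁻¹) * 1# + (∂ y * y ⁻¹) * 1#
      ≈⟨ +-cong (*-identityʳ _) (*-identityʳ _) ⟩
    logD x + logD y
      ∎

  logD-1 : logD 1# ≈ 0#
  logD-1 = trans (*-cong ∂-1 refl) (zeroˡ _)

  logD-^ : ∀ {x} n → ¬ (x ≈ 0#) → logD (x ^ n) ≈ natE n * logD x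
  logD-^ zero    x≉0 = trans logD-1 (sym (zeroˡ _))
  logD-^ {x} (suc n) x≉0 = begin
    logD (x * x ^ n)                 ≈⟨ logD-* x≉0 (^-nonzero n x≉0) ⟩
    logD x + logD (x ^ n)            ≈⟨ +-cong refl (logD-^ n x≉0) ⟩
    logD x + natE n * logD x         ≈⟨ solve 2 (λ l m → l :+ m :* l := (con (+ 1) :+ m) :* l) refl (logD x) (natE n) ⟩
    ((1# + 0#) + natE n) * logD x    ≈⟨ *-cong (+-cong (+-identityʳ 1#) refl) refl ⟩
    (1# + natE n) * logD x           ∎

  logD-⁻¹ : ∀ {x} → ¬ (x ≈ 0#) → logD (x ⁻¹) ≈ - logD x
  logD-⁻¹ {x} x≉0 = begin
    ∂ (x ⁻¹) * (x ⁻¹) ⁻¹               ≈⟨ *-cong (∂-⁻¹ x≉0) (⁻¹-involutive x≉0) ⟩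
    - (∂ x * (x ⁻¹ * x ⁻¹)) * x        ≈⟨ solve 3 (λ x x' d → (:- (d :* (x' :* x'))) :* x
        := :- ((d :* x') :* (x :* x')))
        refl x (x ⁻¹) (∂ x) ⟩
    - ((∂ x * x ⁻¹) * (x * x ⁻¹))      ≈⟨ -‿cong (trans (*-cong refl (⁻¹-inverse x x≉0)) (*-identityʳ _)) ⟩
    - logD x                           ∎

  logD-ratio : ∀ {c e} s t → ¬ (c ≈ 0#) → ¬ (e ≈ 0#) →
    c * (∂ e + t * e) + - ((∂ c + (s + t) * c) * e) ≈ 0# → s ≈ logD (e * c ⁻¹)
  logD-ratio {c} {e} s t c≉0 e≉0 eq = *-cancelˡ (*-nonzero c≉0 e≉0) (begin
    (c * e) * s
      ≈⟨ solve 6 (λ c e c′ e′ s t → (c :* e) :* s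
          := (c :* e′ :+ :- (e :* c′)) :+ :- (c :* (e′ :+ t :* e) :+ :- ((c′ :+ (s :+ t) :* c) :* e)))
          refl c e (∂ c) (∂ e) s t ⟩
    (c * ∂ e + - (e * ∂ c)) + - (c * (∂ e + t * e) + - ((∂ c + (s + t) * c) * e))
      ≈⟨ +-cong refl (trans (-‿cong eq) -0#≈0#) ⟩
    (c * ∂ e + - (e * ∂ c)) + 0#
      ≈⟨ +-identityʳ _ ⟩
    c * ∂ e + - (e * ∂ c)
      ≈⟨ sym (+-cong (*-identityʳ _) (-‿cong (*-identityʳ _))) ⟩
    (c * ∂ e) * 1# + - ((e * ∂ c) * 1#)
      ≈⟨ sym (+-cong (*-cong refl (⁻¹-inverse e e≉0)) (-‿cong (*-cong refl (⁻¹-inverse c c≉0)))) ⟩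
    (c * ∂ e) * (e * e ⁻¹) + - ((e * ∂ c) * (c * c ⁻¹))
      ≈⟨ solve 6 (λ c e c′ e′ e' c' → (c :* e′) :* (e :* e') :+ :- ((e :* c′) :* (c :* c'))
          := (c :* e) :* (e′ :* e' :+ :- (c′ :* c')))
          refl c e (∂ c) (∂ e) (e ⁻¹) (c ⁻¹) ⟩
    (c * e) * (logD e + - logD c)
      ≈⟨ *-cong refl (sym (trans (logD-* e≉0 (⁻¹-nonzero c≉0)) (+-cong refl (logD-⁻¹ c≉0)))) ⟩
    (c * e) * logD (e * c ⁻¹)
      ∎)

  ∂-ℚ-combination : CharZero → ∀ {n} (q : Fin n → ℚ) (v : Fin n → Carrier) →
    ∂ (Σ[ (λ i → ratE (q i) * v i) ]) ≈ Σ[ (λ i → ratE (q i) * ∂ (v i)) ]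
  ∂-ℚ-combination charZero {zero}  q v = ∂-0
  ∂-ℚ-combination charZero {suc n} q v = trans (∂-+ _ _)
    (+-cong (∂-const-* (v zero) (ratE-const charZero (q zero)))
            (∂-ℚ-combination charZero (λ i → q (suc i)) (λ i → v (suc i))))

module LogarithmicSpan {c ℓ} (k : DiffField c ℓ) where
  open DiffField k
  open DiffFieldProperties k
  open import Relation.Binary.Reasoning.Setoid setoid

  InW-from-multiple : CharZero → ∀ {x v} n → IsLog v → ∂ v ≈ natE (suc n) * x → InW x
  InW-from-multiple charZero {x} {v} n v-log v′≈[n+1]x =
    1 , (λ _ → unitFraction n) , (λ _ → v) , (λ _ → v-log) , (begin
      x                                           ≈⟨ sym (*-identityˡ x) ⟩
      1# * x                                      ≈⟨ *-cong (sym (unitFraction-inverse charZero n)) refl ⟩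
      (ratE (unitFraction n) * natE (suc n)) * x  ≈⟨ *-assoc _ _ _ ⟩
      ratE (unitFraction n) * (natE (suc n) * x)  ≈⟨ *-cong refl (sym v′≈[n+1]x) ⟩
      ratE (unitFraction n) * ∂ v                 ≈⟨ sym (+-identityʳ _) ⟩
      ratE (unitFraction n) * ∂ v + 0#            ∎)

  InW⇒derivative : CharZero → ∀ {w} → InW w → Σ Carrier λ v → ∂ v ≈ w
  InW⇒derivative charZero (n , q , v , _ , w≈Σ) =
    Σ[ (λ i → ratE (q i) * v i) ] , trans (∂-ℚ-combination charZero q v) (sym w≈Σ)

  ∂-multiple-logD⇒InW : CharZero → ∀ {f v} n → ¬ (f ≈ 0#) → ∂ v ≈ natE (suc n) * logD f → InW (logD f)
  ∂-multiple-logD⇒InW charZero {f} n f≉0 v′≈[n+1]logDf = InW-from-multiple charZero n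
    (f ^ suc n , ^-nonzero (suc n) f≉0 , trans v′≈[n+1]logDf (sym (logD-^ (suc n) f≉0)))
    v′≈[n+1]logDf

  MultipleOfLogD : Carrier → Set (c ⊔ ℓ)
  MultipleOfLogD w = Σ ℕ λ n → Σ Carrier λ u → ¬ (u ≈ 0#) × (natE (suc n) * w ≈ logD u)

  private
    _^ℤ_ : Carrier → ℤ → Carrier
    u ^ℤ (+ n)    = u ^ n
    u ^ℤ -[1+ n ] = (u ^ suc n) ⁻¹

    ^ℤ-nonzero : ∀ {u} i → ¬ (u ≈ 0#) → ¬ (u ^ℤ i ≈ 0#)
    ^ℤ-nonzero (+ n)    u≉0 = ^-nonzero n u≉0
    ^ℤ-nonzero -[1+ n ] u≉0 = ⁻¹-nonzero (^-nonzero (suc n) u≉0)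

    logD-^ℤ : ∀ {u} i → ¬ (u ≈ 0#) → logD (u ^ℤ i) ≈ intE i * logD u
    logD-^ℤ (+ n)    u≉0 = logD-^ n u≉0
    logD-^ℤ -[1+ n ] u≉0 = trans (logD-⁻¹ (^-nonzero (suc n) u≉0))
      (trans (-‿cong (logD-^ (suc n) u≉0)) (-‿distribˡ-* _ _))

  MultipleOfLogD-cong : ∀ {x y} → x ≈ y → MultipleOfLogD x → MultipleOfLogD y
  MultipleOfLogD-cong x≈y (n , u , u≉0 , eq) = n , u , u≉0 , trans (*-cong refl (sym x≈y)) eq

  MultipleOfLogD-0 : MultipleOfLogD 0#
  MultipleOfLogD-0 = 0 , 1# , 1≉0 , trans (zeroʳ _) (sym logD-1)

  MultipleOfLogD-+ : ∀ {x y} → MultipleOfLogD x → MultipleOfLogD y → MultipleOfLogD (x + y)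
  MultipleOfLogD-+ {x} {y} (n , u , u≉0 , hu) (m , v , v≉0 , hv) =
    m ℕ.+ n ℕ.* suc m , u ^ suc m * v ^ suc n , *-nonzero (^-nonzero (suc m) u≉0) (^-nonzero (suc n) v≉0) ,
    (begin
      natE (suc n ℕ.* suc m) * (x + y)
        ≈⟨ *-cong (natE-* (suc n) (suc m)) refl ⟩
      (natE (suc n) * natE (suc m)) * (x + y)
        ≈⟨ solve 4 (λ N M x y → (N :* M) :* (x :+ y) := M :* (N :* x) :+ N :* (M :* y)) refl (natE (suc n)) (natE (suc m)) x y ⟩
      natE (suc m) * (natE (suc n) * x) + natE (suc n) * (natE (suc m) * y)
        ≈⟨ +-cong (*-cong refl hu) (*-cong refl hv) ⟩
      natE (suc m) * logD u + natE (suc n) * logD v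
        ≈⟨ sym (+-cong (logD-^ (suc m) u≉0) (logD-^ (suc n) v≉0)) ⟩
      logD (u ^ suc m) + logD (v ^ suc n)
        ≈⟨ sym (logD-* (^-nonzero (suc m) u≉0) (^-nonzero (suc n) v≉0)) ⟩
      logD (u ^ suc m * v ^ suc n)
        ∎)

  MultipleOfLogD-term : CharZero → ∀ q {v} → IsLog v → MultipleOfLogD (ratE q * ∂ v)
  MultipleOfLogD-term charZero q {v} (u , u≉0 , v′≈logDu) =
    ℚ.denominator-1 q , u ^ℤ ℚ.numerator q , ^ℤ-nonzero (ℚ.numerator q) u≉0 , (begin
      natE (ℚ.denominatorℕ q) * (ratE q * ∂ v)    ≈⟨ sym (*-assoc _ _ _) ⟩
      (natE (ℚ.denominatorℕ q) * ratE q) * ∂ v    ≈⟨ *-cong (denominator-*-ratE charZero q) v′≈logDu ⟩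
      intE (ℚ.numerator q) * logD u               ≈⟨ sym (logD-^ℤ (ℚ.numerator q) u≉0) ⟩
      logD (u ^ℤ ℚ.numerator q)                   ∎)

  MultipleOfLogD-Σ : CharZero → ∀ {n} (q : Fin n → ℚ) (v : Fin n → Carrier) → (∀ i → IsLog (v i)) →
                     MultipleOfLogD (Σ[ (λ i → ratE (q i) * ∂ (v i)) ])
  MultipleOfLogD-Σ charZero {zero}  q v v-log = MultipleOfLogD-0
  MultipleOfLogD-Σ charZero {suc n} q v v-log = MultipleOfLogD-+ (MultipleOfLogD-term charZero (q zero) (v-log zero))
    (MultipleOfLogD-Σ charZero (λ i → q (suc i)) (λ i → v (suc i)) (λ i → v-log (suc i)))

  InW⇒MultipleOfLogD : CharZero → ∀ {w} → InW w → MultipleOfLogD w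
  InW⇒MultipleOfLogD charZero (n , q , v , v-log , w≈Σ) =
    MultipleOfLogD-cong (sym w≈Σ) (MultipleOfLogD-Σ charZero q v v-log)

  MultipleOfLogD-∂⇒InW : CharZero → ∀ {f} → MultipleOfLogD (∂ f) → InW (∂ f)
  MultipleOfLogD-∂⇒InW charZero {f} (n , u , u≉0 , [n+1]f′≈logDu) =
    InW-from-multiple charZero n (u , u≉0 , trans [n+1]f-derivative [n+1]f′≈logDu) [n+1]f-derivative
    where
    [n+1]f-derivative : ∂ (natE (suc n) * f) ≈ natE (suc n) * ∂ f
    [n+1]f-derivative = ∂-const-* f (natE-const (suc n))

module Polynomials {c ℓ} {k K : DiffField c ℓ} (e : DiffExt k K) (θ : DiffField.Carrier K) where
  private
    module k = DiffField k
    module kP = DiffFieldProperties k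
  open DiffField K
  open DiffFieldProperties K
  open DiffExt e
  open import Relation.Binary.Reasoning.Setoid setoid

  Nonzero : k.Carrier → Set ℓ
  Nonzero x = ¬ (x k.≈ k.0#)

  ι-0 : ι k.0# ≈ 0#
  ι-0 = x+x≈x⇒x≈0 _ (trans (sym (ι-+ _ _)) (ι-cong (kP.+-identityʳ k.0#)))

  ι-neg : ∀ x → ι (k.- x) ≈ - ι x
  ι-neg x = +-inverseʳ-unique (ι x) (ι (k.- x))
    (trans (sym (ι-+ _ _)) (trans (ι-cong (kP.-‿inverseʳ x)) ι-0))

  ∂-ι : ∀ x → ∂ (ι x) ≈ ι (k.∂ x)
  ∂-ι x = sym (ι-∂ x)

  ι-natE-suc-* : ∀ n x → ι (k.natE (suc n) k.* x) ≈ ι x + ι (k.natE n k.* x)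
  ι-natE-suc-* n x = trans (ι-cong (kP.natE-suc-* n x)) (ι-+ _ _)

  ι-nonzero : ∀ {x} → Nonzero x → ¬ (ι x ≈ 0#)
  ι-nonzero x≉0 ιx≈0 = x≉0 (ι-inj (trans ιx≈0 (sym ι-0)))

  ι-*-+-*-neg : ∀ s x t y → ι (s k.* x k.+ k.- (t k.* y)) ≈ ι s * ι x + - (ι t * ι y)
  ι-*-+-*-neg s x t y = trans (ι-+ _ _) (+-cong (ι-* s x) (trans (ι-neg _) (-‿cong (ι-* t y))))

  -- Coefficient lists with the leading coefficient first: d ∷ ds stands for d θⁿ + ds(θ), n = length ds.
  evalDesc : List k.Carrier → Carrier
  evalDesc []       = 0#
  evalDesc (d ∷ ds) = ι d * θ ^ length ds + evalDesc ds

  evalDesc-snoc : ∀ ds d → evalDesc (ds ++ d ∷ []) ≈ θ * evalDesc ds + ι d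
  evalDesc-snoc []        d = trans (+-identityʳ _) (trans (*-identityʳ _)
    (sym (trans (+-cong (zeroʳ θ) refl) (+-identityˡ _))))
  evalDesc-snoc (d′ ∷ ds) d = begin
    ι d′ * θ ^ length (ds ++ d ∷ []) + evalDesc (ds ++ d ∷ [])
      ≈⟨ +-cong (*-cong refl (reflexive (≡.cong (θ ^_) length-snoc))) (evalDesc-snoc ds d) ⟩
    ι d′ * (θ * θ ^ length ds) + (θ * evalDesc ds + ι d)
      ≈⟨ solve 5 (λ D t p v X → D :* (t :* p) :+ (t :* v :+ X)
          := t :* (D :* p :+ v) :+ X)
          refl (ι d′) θ (θ ^ length ds) (evalDesc ds) (ι d) ⟩
    θ * (ι d′ * θ ^ length ds + evalDesc ds) + ι d
      ∎
    where
    length-snoc : length (ds ++ d ∷ []) ≡ suc (length ds)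
    length-snoc = ≡.trans (List.length-++-sucʳ ds d []) (≡.cong (λ xs → suc (length xs)) (List.++-identityʳ ds))

  eval≈evalDesc-reverse : ∀ p → eval p θ ≈ evalDesc (reverse p)
  eval≈evalDesc-reverse []      = refl
  eval≈evalDesc-reverse (d ∷ p) = begin
    ι d + θ * eval p θ                 ≈⟨ +-cong refl (*-cong refl (eval≈evalDesc-reverse p)) ⟩
    ι d + θ * evalDesc (reverse p)     ≈⟨ +-comm _ _ ⟩
    θ * evalDesc (reverse p) + ι d     ≈⟨ sym (evalDesc-snoc (reverse p) d) ⟩
    evalDesc (reverse p ++ d ∷ [])     ≈⟨ reflexive (≡.cong evalDesc (≡.sym (List.unfold-reverse d p))) ⟩
    evalDesc (reverse (d ∷ p))         ∎

  evalDesc-zero-head : ∀ {d} ds → d k.≈ k.0# → evalDesc (d ∷ ds) ≈ evalDesc ds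
  evalDesc-zero-head ds d≈0 =
    trans (+-cong (trans (*-cong (trans (ι-cong d≈0) ι-0) refl) (zeroˡ _)) refl) (+-identityˡ _)

  evalDesc-zeros : ∀ ds → All (k._≈ k.0#) ds → evalDesc ds ≈ 0#
  evalDesc-zeros []       []           = refl
  evalDesc-zeros (d ∷ ds) (d≈0 ∷ ds≈0) = trans (evalDesc-zero-head ds d≈0) (evalDesc-zeros ds ds≈0)

  DegreeDescent : Set (c ⊔ ℓ)
  DegreeDescent = ∀ x xs → Nonzero x → evalDesc (x ∷ xs) ≈ 0# →
    Σ (List k.Carrier) λ ys → length ys ≡ length xs × evalDesc ys ≈ 0# × ¬ ¬ Any Nonzero ys

  module _ (degreeDescent : DegreeDescent) where
    no-root : ∀ n ds → length ds ℕ.≤ n → Any Nonzero ds → ¬ (evalDesc ds ≈ 0#)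
    no-root n       []       _         ()
    no-root zero    (x ∷ xs) ()
    no-root (suc n) (x ∷ xs) (s≤s |xs|≤n) nonzero root = by-leading-coefficient
      where
      lower-terms : x k.≈ k.0# → Any Nonzero (x ∷ xs) → ⊥
      lower-terms x≈0 (here x≉0)     = x≉0 x≈0
      lower-terms x≈0 (there xs≉0) =
        no-root n xs |xs|≤n xs≉0 (trans (sym (evalDesc-zero-head xs x≈0)) root)

      by-leading-coefficient : ⊥
      by-leading-coefficient with degreeDescent x xs (λ x≈0 → lower-terms x≈0 nonzero) root
      ... | ys , |ys|≡|xs| , ys-root , ¬¬ys≉0 =
        ¬¬ys≉0 (λ ys≉0 → no-root n ys (≡.subst (ℕ._≤ n) (≡.sym |ys|≡|xs|) |xs|≤n) ys≉0 ys-root)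

    DegreeDescent⇒transcendental : IsTranscendental θ
    DegreeDescent⇒transcendental (p , p≉0 , p-root) =
      no-root _ (reverse p) ℕ.≤-refl (Any.reverse⁺ p≉0) (trans (sym (eval≈evalDesc-reverse p)) p-root)

  scaledDifference : k.Carrier → k.Carrier → List k.Carrier → List k.Carrier → List k.Carrier
  scaledDifference s t = zipWith (λ x y → s k.* x k.+ k.- (t k.* y))

  length-scaledDifference : ∀ s t xs ys → length xs ≡ length ys →
                            length (scaledDifference s t xs ys) ≡ length ys
  length-scaledDifference s t []       []       _  = ≡.refl
  length-scaledDifference s t (x ∷ xs) (y ∷ ys) eq =
    ≡.cong suc (length-scaledDifference s t xs ys (ℕ.suc-injective eq))

  evalDesc-scaledDifference : ∀ s t xs ys → length xs ≡ length ys →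
    evalDesc (scaledDifference s t xs ys) ≈ ι s * evalDesc xs + - (ι t * evalDesc ys)
  evalDesc-scaledDifference s t []       []       _  =
    solve 2 (λ S T → con (+ 0) := S :* con (+ 0) :+ :- (T :* con (+ 0))) refl (ι s) (ι t)
  evalDesc-scaledDifference s t (x ∷ xs) (y ∷ ys) eq = begin
    ι (s k.* x k.+ k.- (t k.* y)) * θ ^ length (scaledDifference s t xs ys) + evalDesc (scaledDifference s t xs ys)
      ≈⟨ +-cong (*-cong (ι-*-+-*-neg s x t y) (reflexive (≡.cong (θ ^_) (length-scaledDifference s t xs ys eq′))))
                (evalDesc-scaledDifference s t xs ys eq′) ⟩
    (ι s * ι x + - (ι t * ι y)) * θ ^ length ys + (ι s * evalDesc xs + - (ι t * evalDesc ys))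
      ≈⟨ solve 7 (λ S T X Y p A B → (S :* X :+ :- (T :* Y)) :* p :+ (S :* A :+ :- (T :* B))
          := S :* (X :* p :+ A) :+ :- (T :* (Y :* p :+ B)))
          refl (ι s) (ι t) (ι x) (ι y) (θ ^ length ys) (evalDesc xs) (evalDesc ys) ⟩
    ι s * (ι x * θ ^ length ys + evalDesc xs) + - (ι t * (ι y * θ ^ length ys + evalDesc ys))
      ≈⟨ +-cong (*-cong refl (+-cong (*-cong refl (reflexive (≡.cong (θ ^_) (≡.sym eq′)))) refl)) refl ⟩
    ι s * evalDesc (x ∷ xs) + - (ι t * evalDesc (y ∷ ys))
      ∎
    where
    eq′ : length xs ≡ length ys
    eq′ = ℕ.suc-injective eq

  scaledDifference-root : ∀ x xs l ls → length ls ≡ length xs →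
    evalDesc (x ∷ xs) ≈ 0# → evalDesc (l ∷ ls) ≈ 0# → evalDesc (scaledDifference x l ls xs) ≈ 0#
  scaledDifference-root x xs l ls |ls|≡|xs| x-root l-root = begin
    evalDesc (scaledDifference x l ls xs)
      ≈⟨ evalDesc-scaledDifference x l ls xs |ls|≡|xs| ⟩
    ι x * evalDesc ls + - (ι l * evalDesc xs)
      ≈⟨ +-cong (*-cong refl (lower-terms ls l-root)) (-‿cong (*-cong refl (lower-terms xs x-root))) ⟩
    ι x * - (ι l * θ ^ length ls) + - (ι l * - (ι x * θ ^ length xs))
      ≈⟨ +-cong refl (-‿cong (*-cong refl (-‿cong (*-cong refl (reflexive (≡.cong (θ ^_) (≡.sym |ls|≡|xs|))))))) ⟩
    ι x * - (ι l * θ ^ length ls) + - (ι l * - (ι x * θ ^ length ls))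
      ≈⟨ solve 3 (λ X L p → X :* :- (L :* p) :+ :- (L :* :- (X :* p)) := con (+ 0)) refl (ι x) (ι l) (θ ^ length ls) ⟩
    0#
      ∎
    where
    lower-terms : ∀ {d} ds → evalDesc (d ∷ ds) ≈ 0# → evalDesc ds ≈ - (ι d * θ ^ length ds)
    lower-terms ds = +-inverseʳ-unique _ _

module Primitive {c ℓ} {k K : DiffField c ℓ} (e : DiffExt k K)
  (θ : DiffField.Carrier K) (a : DiffField.Carrier k)
  (θ′≈a : DiffField._≈_ K (DiffField.∂ K θ) (DiffExt.ι e a)) where
  private
    module k = DiffField k
    module kP = DiffFieldProperties k
  open DiffField K
  open DiffFieldProperties K
  open DiffExt e
  open Polynomials e θ
  open import Relation.Binary.Reasoning.Setoid setoid

  ∂-^-suc : ∀ m → ∂ (θ ^ suc m) ≈ ι (k.natE (suc m) k.* a) * θ ^ m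
  ∂-^-suc zero = begin
    ∂ (θ * 1#)                       ≈⟨ ∂-* θ 1# ⟩
    ∂ θ * 1# + θ * ∂ 1#              ≈⟨ +-cong (*-cong θ′≈a refl) (trans (*-cong refl ∂-1) (zeroʳ θ)) ⟩
    ι a * 1# + 0#                    ≈⟨ +-identityʳ _ ⟩
    ι a * 1#                         ≈⟨ *-cong (ι-cong (k.sym (k.trans (kP.natE-suc-* 0 a)
                                          (k.trans (kP.+-cong k.refl (kP.zeroˡ a)) (kP.+-identityʳ a))))) refl ⟩
    ι (k.natE 1 k.* a) * 1#          ∎
  ∂-^-suc (suc m) = begin
    ∂ (θ * θ ^ suc m)
      ≈⟨ ∂-* θ (θ ^ suc m) ⟩
    ∂ θ * θ ^ suc m + θ * ∂ (θ ^ suc m)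
      ≈⟨ +-cong (*-cong θ′≈a refl) (*-cong refl (∂-^-suc m)) ⟩
    ι a * (θ * θ ^ m) + θ * (ι (k.natE (suc m) k.* a) * θ ^ m)
      ≈⟨ solve 4 (λ A M t p → A :* (t :* p) :+ t :* (M :* p)
          := (A :+ M) :* (t :* p))
          refl (ι a) (ι (k.natE (suc m) k.* a)) θ (θ ^ m) ⟩
    (ι a + ι (k.natE (suc m) k.* a)) * (θ * θ ^ m)
      ≈⟨ *-cong (sym (ι-natE-suc-* (suc m) a)) refl ⟩
    ι (k.natE (suc (suc m)) k.* a) * (θ * θ ^ m)
      ∎

  addToHead : k.Carrier → List k.Carrier → List k.Carrier
  addToHead x []       = []
  addToHead x (y ∷ ys) = x k.+ y ∷ ys

  length-addToHead : ∀ x ys → length (addToHead x ys) ≡ length ys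
  length-addToHead x []       = ≡.refl
  length-addToHead x (y ∷ ys) = ≡.refl

  -- (d θⁿ)′ = d′ θⁿ + n a d θⁿ⁻¹
  derivative : List k.Carrier → List k.Carrier
  derivative []       = []
  derivative (d ∷ ds) = k.∂ d ∷ addToHead (k.natE (length ds) k.* a k.* d) (derivative ds)

  length-derivative : ∀ ds → length (derivative ds) ≡ length ds
  length-derivative []       = ≡.refl
  length-derivative (d ∷ ds) =
    ≡.cong suc (≡.trans (length-addToHead _ (derivative ds)) (length-derivative ds))

  ∂-evalDesc : ∀ ds → ∂ (evalDesc ds) ≈ evalDesc (derivative ds)
  ∂-evalDesc []           = ∂-0
  ∂-evalDesc (d ∷ [])     = begin
    ∂ (ι d * 1# + 0#)                       ≈⟨ trans (∂-+ _ _) (+-cong (∂-* _ _) ∂-0) ⟩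
    (∂ (ι d) * 1# + ι d * ∂ 1#) + 0#        ≈⟨ +-cong (+-cong (*-cong (∂-ι d) refl) (*-cong refl ∂-1)) refl ⟩
    (ι (k.∂ d) * 1# + ι d * 0#) + 0#        ≈⟨ +-cong (trans (+-cong refl (zeroʳ _)) (+-identityʳ _)) refl ⟩
    ι (k.∂ d) * 1# + 0#                     ∎
  ∂-evalDesc (d ∷ y ∷ ys) = begin
    ∂ (ι d * θ ^ suc m + evalDesc (y ∷ ys))
      ≈⟨ trans (∂-+ _ _) (+-cong (∂-* _ _) (∂-evalDesc (y ∷ ys))) ⟩
    (∂ (ι d) * θ ^ suc m + ι d * ∂ (θ ^ suc m)) + (ι (k.∂ y) * θ ^ length zs + evalDesc zs)
      ≈⟨ +-cong (+-cong (*-cong (∂-ι d) refl) (*-cong refl (∂-^-suc m)))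
                (+-cong (*-cong refl (reflexive (≡.cong (θ ^_) |zs|≡m))) refl) ⟩
    (ι (k.∂ d) * (θ * θ ^ m) + ι d * (ι (k.natE (suc m) k.* a) * θ ^ m)) + (ι (k.∂ y) * θ ^ m + evalDesc zs)
      ≈⟨ solve 7 (λ D′ D M t p Y′ Z → (D′ :* (t :* p) :+ D :* (M :* p)) :+ (Y′ :* p :+ Z)
          := D′ :* (t :* p) :+ ((M :* D :+ Y′) :* p :+ Z))
          refl (ι (k.∂ d)) (ι d) (ι (k.natE (suc m) k.* a)) θ (θ ^ m) (ι (k.∂ y)) (evalDesc zs) ⟩
    ι (k.∂ d) * (θ * θ ^ m) + ((ι (k.natE (suc m) k.* a) * ι d + ι (k.∂ y)) * θ ^ m + evalDesc zs)
      ≈⟨ +-cong (*-cong refl (reflexive (≡.cong (λ j → θ ^ suc j) (≡.sym |zs|≡m))))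
                (+-cong (*-cong (sym (trans (ι-+ _ _) (+-cong (ι-* _ _) refl))) (reflexive (≡.cong (θ ^_) (≡.sym |zs|≡m)))) refl) ⟩
    ι (k.∂ d) * θ ^ suc (length zs) + (ι (k.natE (suc m) k.* a k.* d k.+ k.∂ y) * θ ^ length zs + evalDesc zs)
      ∎
    where
    m : ℕ
    m = length ys
    zs : List k.Carrier
    zs = addToHead (k.natE m k.* a k.* y) (derivative ys)
    |zs|≡m : length zs ≡ m
    |zs|≡m = ≡.trans (length-addToHead _ (derivative ys)) (length-derivative ys)

  -- Only the top coefficient of the reduced relation is inspected: it vanishes
  -- only if (−y/x)′ = n a, where x θⁿ + y θⁿ⁻¹ + … is the original relation.
  degreeDescent : (∀ n v → ¬ (k.∂ v k.≈ k.natE (suc n) k.* a)) → DegreeDescent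
  degreeDescent no-multiple x xs x≉0 root =
    scaledDifference x (k.∂ x) tail xs ,
    length-scaledDifference x (k.∂ x) tail xs |tail|≡|xs| ,
    scaledDifference-root x xs (k.∂ x) tail |tail|≡|xs| root derivative-root ,
    top-nonzero xs ≡.refl
    where
    tail : List k.Carrier
    tail = addToHead (k.natE (length xs) k.* a k.* x) (derivative xs)

    |tail|≡|xs| : length tail ≡ length xs
    |tail|≡|xs| = ≡.trans (length-addToHead _ (derivative xs)) (length-derivative xs)

    derivative-root : evalDesc (derivative (x ∷ xs)) ≈ 0#
    derivative-root = trans (sym (∂-evalDesc (x ∷ xs))) (trans (∂-cong root) ∂-0)

    top-nonzero : ∀ zs → zs ≡ xs → ¬ ¬ Any Nonzero (scaledDifference x (k.∂ x) tail xs)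
    top-nonzero []       ≡.refl _    = ι-nonzero x≉0 (trans (sym (trans (+-identityʳ _) (*-identityʳ _))) root)
    top-nonzero (y ∷ ys) ≡.refl ¬any = ¬any (here λ top≈0 →
      no-multiple (length ys) (k.- (y k.* x k.⁻¹)) (kP.∂-neg-ratio _ y x≉0 top≈0))

  integral⇒algebraic : SameConstants → ∀ w → k.∂ w k.≈ a → IsAlgebraic θ
  integral⇒algebraic sameConstants w w′≈a =
    k.- (c₀ k.+ w) ∷ k.1# ∷ [] , there (here k.1≉0) , (begin
      ι (k.- (c₀ k.+ w)) + θ * (ι k.1# + θ * 0#)
        ≈⟨ +-cong (trans (ι-neg _) (-‿cong (ι-+ _ _))) (*-cong refl (trans (+-cong ι-1 (zeroʳ θ)) (+-identityʳ 1#))) ⟩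
      - (ι c₀ + ι w) + θ * 1#
        ≈⟨ +-cong (-‿cong (+-cong ιc₀≈θ-w refl)) (*-identityʳ θ) ⟩
      - ((θ + - ι w) + ι w) + θ
        ≈⟨ solve 2 (λ t W → :- ((t :+ :- W) :+ W) :+ t := con (+ 0)) refl θ (ι w) ⟩
      0#
        ∎)
    where
    θ-w-const : IsConst (θ + - ι w)
    θ-w-const = begin
      ∂ (θ + - ι w)       ≈⟨ ∂-+ _ _ ⟩
      ∂ θ + ∂ (- ι w)     ≈⟨ +-cong θ′≈a (trans (∂-neg _) (-‿cong (trans (∂-ι w) (ι-cong w′≈a)))) ⟩
      ι a + - ι a         ≈⟨ -‿inverseʳ _ ⟩
      0#                  ∎
    c₀ : k.Carrier
    c₀ = proj₁ (sameConstants _ θ-w-const)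
    ιc₀≈θ-w : ι c₀ ≈ θ + - ι w
    ιc₀≈θ-w = proj₂ (sameConstants _ θ-w-const)

module Exponential {c ℓ} {k K : DiffField c ℓ} (e : DiffExt k K)
  (θ : DiffField.Carrier K) (b : DiffField.Carrier k)
  (θ′≈bθ : DiffField._≈_ K (DiffField.∂ K θ) (DiffField._*_ K (DiffExt.ι e b) θ)) where
  private
    module k = DiffField k
    module kP = DiffFieldProperties k
  open DiffField K
  open DiffFieldProperties K
  open DiffExt e
  open Polynomials e θ
  open LogarithmicSpan k using (MultipleOfLogD)
  open import Relation.Binary.Reasoning.Setoid setoid

  ∂-^ : ∀ m → ∂ (θ ^ m) ≈ ι (k.natE m k.* b) * θ ^ m
  ∂-^ zero    = trans ∂-1 (sym (trans (*-cong (trans (ι-cong (kP.zeroˡ b)) ι-0) refl) (zeroˡ _)))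
  ∂-^ (suc m) = begin
    ∂ (θ * θ ^ m)
      ≈⟨ ∂-* θ (θ ^ m) ⟩
    ∂ θ * θ ^ m + θ * ∂ (θ ^ m)
      ≈⟨ +-cong (*-cong θ′≈bθ refl) (*-cong refl (∂-^ m)) ⟩
    (ι b * θ) * θ ^ m + θ * (ι (k.natE m k.* b) * θ ^ m)
      ≈⟨ solve 4 (λ B M t p → (B :* t) :* p :+ t :* (M :* p) := (B :+ M) :* (t :* p)) refl (ι b) (ι (k.natE m k.* b)) θ (θ ^ m) ⟩
    (ι b + ι (k.natE m k.* b)) * (θ * θ ^ m)
      ≈⟨ *-cong (sym (ι-natE-suc-* m b)) refl ⟩
    ι (k.natE (suc m) k.* b) * (θ * θ ^ m)
      ∎

  -- (d θⁿ)′ = (d′ + n b d) θⁿ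
  derivative : List k.Carrier → List k.Carrier
  derivative []       = []
  derivative (d ∷ ds) = k.∂ d k.+ k.natE (length ds) k.* b k.* d ∷ derivative ds

  length-derivative : ∀ ds → length (derivative ds) ≡ length ds
  length-derivative []       = ≡.refl
  length-derivative (d ∷ ds) = ≡.cong suc (length-derivative ds)

  ∂-evalDesc : ∀ ds → ∂ (evalDesc ds) ≈ evalDesc (derivative ds)
  ∂-evalDesc []       = ∂-0
  ∂-evalDesc (d ∷ ds) = begin
    ∂ (ι d * θ ^ n + evalDesc ds)
      ≈⟨ trans (∂-+ _ _) (+-cong (∂-* _ _) (∂-evalDesc ds)) ⟩
    (∂ (ι d) * θ ^ n + ι d * ∂ (θ ^ n)) + evalDesc (derivative ds)
      ≈⟨ +-cong (+-cong (*-cong (∂-ι d) refl) (*-cong refl (∂-^ n))) refl ⟩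
    (ι (k.∂ d) * θ ^ n + ι d * (ι (k.natE n k.* b) * θ ^ n)) + evalDesc (derivative ds)
      ≈⟨ +-cong (solve 4 (λ D′ D M p → D′ :* p :+ D :* (M :* p)
          := (D′ :+ M :* D) :* p)
          refl (ι (k.∂ d)) (ι d) (ι (k.natE n k.* b)) (θ ^ n)) refl ⟩
    (ι (k.∂ d) + ι (k.natE n k.* b) * ι d) * θ ^ n + evalDesc (derivative ds)
      ≈⟨ +-cong (*-cong (sym (trans (ι-+ _ _) (+-cong refl (ι-* _ _)))) (reflexive (≡.cong (θ ^_) (≡.sym (length-derivative ds))))) refl ⟩
    ι (k.∂ d k.+ k.natE n k.* b k.* d) * θ ^ length (derivative ds) + evalDesc (derivative ds)
      ∎
    where
    n : ℕ
    n = length ds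

  private
    reduced-coefficient : k.Carrier → k.Carrier → ℕ → k.Carrier → k.Carrier
    reduced-coefficient x l m y = x k.* (k.∂ y k.+ k.natE m k.* b k.* y) k.+ k.- (l k.* y)

    locate-nonzero-coefficient : ∀ x l ys → Any Nonzero ys →
      All (λ z → ¬ Nonzero z) (scaledDifference x l (derivative ys) ys) →
      Σ k.Carrier λ y → Σ ℕ λ d → Σ ℕ λ m → suc (d ℕ.+ m) ≡ length ys × Nonzero y ×
        ¬ Nonzero (reduced-coefficient x l m y)
    locate-nonzero-coefficient x l (y ∷ ys) (here y≉0) (¬y-coeff≉0 ∷ _) =
      y , 0 , length ys , ≡.refl , y≉0 , ¬y-coeff≉0
    locate-nonzero-coefficient x l (y ∷ ys) (there ys≉0) (_ ∷ ¬ys-coeffs≉0)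
      with locate-nonzero-coefficient x l ys ys≉0 ¬ys-coeffs≉0
    ... | z , d , m , eq , z≉0 , ¬z-coeff≉0 = z , suc d , m , ≡.cong suc eq , z≉0 , ¬z-coeff≉0

  -- If every reduced coefficient vanished, a nonzero coefficient y of θᵐ, m < n, would satisfy
  -- x (y′ + m b y) = (x′ + n b x) y, i.e. (n − m) b = (y/x)′/(y/x).
  degreeDescent : ¬ (θ ≈ 0#) → ¬ MultipleOfLogD b → DegreeDescent
  degreeDescent θ≉0 no-multiple x xs x≉0 root =
    scaledDifference x l (derivative xs) xs ,
    length-scaledDifference x l (derivative xs) xs (length-derivative xs) ,
    scaledDifference-root x xs l (derivative xs) (length-derivative xs) root derivative-root ,
    reduced-nonzero
    where
    l : k.Carrier
    l = k.∂ x k.+ k.natE (length xs) k.* b k.* x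

    derivative-root : evalDesc (derivative (x ∷ xs)) ≈ 0#
    derivative-root = trans (sym (∂-evalDesc (x ∷ xs))) (trans (∂-cong root) ∂-0)

    lower-terms-nonzero : ¬ ¬ Any Nonzero xs
    lower-terms-nonzero ¬any = All¬¬⇒¬¬All xs (¬Any⇒All¬ xs ¬any) λ all≈0 →
      *-nonzero (ι-nonzero x≉0) (^-nonzero (length xs) θ≉0)
        (trans (sym (+-identityʳ _)) (trans (+-cong refl (sym (evalDesc-zeros xs all≈0))) root))

    natE-split-* : ∀ {n} d m → suc (d ℕ.+ m) ≡ n →
                   k.natE n k.* b k.≈ k.natE (suc d) k.* b k.+ k.natE m k.* b
    natE-split-* d m ≡.refl = k.trans (kP.*-cong (kP.natE-+ (suc d) m) k.refl) (kP.distribʳ _ _ _)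

    reduced-nonzero : ¬ ¬ Any Nonzero (scaledDifference x l (derivative xs) xs)
    reduced-nonzero ¬any = lower-terms-nonzero λ xs≉0 →
      let y , d , m , 1+d+m≡|xs| , y≉0 , ¬y-coefficient≉0 =
            locate-nonzero-coefficient x l xs xs≉0 (¬Any⇒All¬ _ ¬any)
      in ¬y-coefficient≉0 λ y-coefficient≈0 →
           no-multiple (d , y k.* x k.⁻¹ , kP.*-nonzero y≉0 (kP.⁻¹-nonzero x≉0) ,
             kP.logD-ratio (k.natE (suc d) k.* b) (k.natE m k.* b) x≉0 y≉0
               (k.trans (kP.+-cong k.refl (kP.-‿cong (kP.*-cong (kP.+-cong k.refl
                          (kP.*-cong (k.sym (natE-split-* d m 1+d+m≡|xs|)) k.refl)) k.refl)))
                        y-coefficient≈0))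

  monomial : ℕ → List k.Carrier
  monomial zero    = k.1# ∷ []
  monomial (suc n) = k.0# ∷ monomial n

  eval-monomial : ∀ n → eval (monomial n) θ ≈ θ ^ n
  eval-monomial zero    = trans (+-cong ι-1 (zeroʳ θ)) (+-identityʳ 1#)
  eval-monomial (suc n) = trans (+-cong ι-0 (*-cong refl (eval-monomial n))) (+-identityˡ _)

  monomial-nonzero : ∀ n → Any Nonzero (monomial n)
  monomial-nonzero zero    = here k.1≉0
  monomial-nonzero (suc n) = there (monomial-nonzero n)

  -- If (n+1) b = u′/u then θⁿ⁺¹/u is constant, so θⁿ⁺¹ = c₀ u with c₀ ∈ k.
  multipleOfLogD⇒algebraic : SameConstants → MultipleOfLogD b → IsAlgebraic θ
  multipleOfLogD⇒algebraic sameConstants (n , u , u≉0 , [n+1]b≈logDu) =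
    k.- (c₀ k.* u) ∷ monomial n , there (monomial-nonzero n) , (begin
      ι (k.- (c₀ k.* u)) + θ * eval (monomial n) θ
        ≈⟨ +-cong (trans (ι-neg _) (-‿cong (ι-* _ _))) (*-cong refl (eval-monomial n)) ⟩
      - (ι c₀ * ι u) + θ ^ suc n
        ≈⟨ +-cong refl θ^[n+1]≈c₀u ⟩
      - (ι c₀ * ι u) + ι c₀ * ι u
        ≈⟨ -‿inverseˡ _ ⟩
      0#
        ∎)
    where
    B : Carrier
    B = ι (k.natE (suc n) k.* b)

    ∂-u⁻¹ : k.∂ (u k.⁻¹) k.≈ k.- (k.natE (suc n) k.* b k.* u k.⁻¹)
    ∂-u⁻¹ = k.trans (kP.∂-⁻¹ u≉0)
      (kP.-‿cong (k.trans (k.sym (kP.*-assoc _ _ _)) (kP.*-cong (k.sym [n+1]b≈logDu) k.refl)))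

    ratio-const : IsConst (θ ^ suc n * ι (u k.⁻¹))
    ratio-const = begin
      ∂ (θ ^ suc n * ι (u k.⁻¹))
        ≈⟨ ∂-* _ _ ⟩
      ∂ (θ ^ suc n) * ι (u k.⁻¹) + θ ^ suc n * ∂ (ι (u k.⁻¹))
        ≈⟨ +-cong (*-cong (∂-^ (suc n)) refl)
                  (*-cong refl (trans (∂-ι _) (trans (ι-cong ∂-u⁻¹) (trans (ι-neg _) (-‿cong (ι-* _ _)))))) ⟩
      (B * θ ^ suc n) * ι (u k.⁻¹) + θ ^ suc n * - (B * ι (u k.⁻¹))
        ≈⟨ solve 3 (λ B p U → (B :* p) :* U :+ p :* :- (B :* U) := con (+ 0)) refl B (θ ^ suc n) (ι (u k.⁻¹)) ⟩
      0#
        ∎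

    c₀ : k.Carrier
    c₀ = proj₁ (sameConstants _ ratio-const)
    ιc₀≈ratio : ι c₀ ≈ θ ^ suc n * ι (u k.⁻¹)
    ιc₀≈ratio = proj₂ (sameConstants _ ratio-const)

    θ^[n+1]≈c₀u : θ ^ suc n ≈ ι c₀ * ι u
    θ^[n+1]≈c₀u = begin
      θ ^ suc n                          ≈⟨ sym (*-identityʳ _) ⟩
      θ ^ suc n * 1#                     ≈⟨ *-cong refl (sym (trans (sym (ι-* _ u)) (trans (ι-cong (kP.⁻¹-inverseˡ u≉0)) ι-1))) ⟩
      θ ^ suc n * (ι (u k.⁻¹) * ι u)     ≈⟨ sym (*-assoc _ _ _) ⟩
      (θ ^ suc n * ι (u k.⁻¹)) * ι u     ≈⟨ *-cong (sym ιc₀≈ratio) refl ⟩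
      ι c₀ * ι u                         ∎

lemma12 : ∀ {c ℓ} (k : DiffField c ℓ) → DiffField.CharZero k → LClosed k →
    (K : DiffField c ℓ) (e : DiffExt k K) (θ : DiffField.Carrier K) →
    DiffExt.GeneratedBy e θ → DiffExt.SameConstants e →
    ((f : DiffField.Carrier k) → ¬ (DiffField._≈_ k f (DiffField.0# k)) →
      DiffField._≈_ K (DiffField.∂ K θ) (DiffExt.ι e (DiffField.logD k f)) →
      (DiffExt.IsTranscendental e θ ⇔ (¬ DiffField.InW k (DiffField.logD k f))))
    ×
    ((f : DiffField.Carrier k) → ¬ (DiffField._≈_ K θ (DiffField.0# K)) →
      DiffField._≈_ K (DiffField.∂ K θ) (DiffField._*_ K (DiffExt.ι e (DiffField.∂ k f)) θ) →
      (DiffExt.IsTranscendental e θ ⇔ (¬ DiffField.InW k (DiffField.∂ k f))))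
lemma12 k charZero _ K e θ _ sameConstants =
  (λ f f≉0 θ′≈logDf → mk⇔
    (λ transcendental logDf∈W →
      let w , w′≈logDf = InW⇒derivative charZero logDf∈W
      in transcendental (Primitive.integral⇒algebraic e θ (logD f) θ′≈logDf sameConstants w w′≈logDf))
    (λ logDf∉W → DegreeDescent⇒transcendental (Primitive.degreeDescent e θ (logD f) θ′≈logDf
      (λ n v v′≈[n+1]logDf → logDf∉W (∂-multiple-logD⇒InW charZero n f≉0 v′≈[n+1]logDf))))) ,
  (λ f θ≉0 θ′≈f′θ → mk⇔
    (λ transcendental f′∈W → transcendental (Exponential.multipleOfLogD⇒algebraic e θ (∂ f) θ′≈f′θ
      sameConstants (InW⇒MultipleOfLogD charZero f′∈W)))
    (λ f′∉W → DegreeDescent⇒transcendental (Exponential.degreeDescent e θ (∂ f) θ′≈f′θ θ≉0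
      (λ multiple → f′∉W (MultipleOfLogD-∂⇒InW charZero multiple)))))
  where
  open DiffField k using (∂; logD)
  open LogarithmicSpan k
  open Polynomials e θ using (DegreeDescent⇒transcendental)
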